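{- Let $G$ be a 2-connected outerplanar near-triangulation with $V(G)=\{u,v_1,\dots,v_k\}$, $k>1$, $N_G(u)=\{v_1,\dots,v_k\}$ and $\deg_G(v_1)=\deg_G(v_k)=2$, with $v_1,\dots,v_k$ labelled consecutively along the path $G-u$. Then $P(G)$ contains non-vanishing monomials $\eta_1u^1v_1^0\prod_{i=2}^{k}v_i^2$ and $\eta_2u^1v_k^0\prod_{i=1}^{k-1}v_i^2$.
   Context: For a graph $G$, vertices are also variables and $P(G)=\prod_{xy\in E(G),\,x<y}(x-y)$ for a fixed arbitrary orientation; a monomial is non-vanishing if its coefficient is nonzero. A 2-connected outerplanar near-triangulation is a 2-connected outerplanar graph embedded with all vertices on the outer cycle and all bounded faces triangles. -}

module Defs where

open import Data.Nat as ℕ using (ℕ; zero; suc; _+_; pred)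
open import Data.Integer as ℤ using (ℤ; 0ℤ; 1ℤ; -1ℤ)
open import Data.Fin using (Fin; zero; suc; toℕ)
open import Data.Vec using (Vec; []; _∷_; replicate; zipWith; tabulate)
open import Data.Vec.Properties using (≡-dec)
open import Data.List using (List; []; _∷_; map; concatMap; foldr; allFin; sum; zip; upTo)
open import Data.Product using (_×_; _,_; proj₁; proj₂)
open import Data.Bool using (Bool; true; false; if_then_else_)
open import Relation.Nullary using (yes; no)

-- Multivariate integer polynomials in n variables x_0,…,x_{n-1},
-- represented (non-canonically) as a formal sum of terms c·x^e.
Poly : ℕ → Set
Poly n = List (ℤ × Vec ℕ n)

unitExp : ∀ {n} → Fin n → Vec ℕ n
unitExp zero    = 1 ∷ replicate _ 0
unitExp (suc i) = 0 ∷ unitExp i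

onePoly : ∀ {n} → Poly n
onePoly = (1ℤ , replicate _ 0) ∷ []

diffPoly : ∀ {n} → Fin n → Fin n → Poly n
diffPoly a b = (1ℤ , unitExp a) ∷ (-1ℤ , unitExp b) ∷ []

mulPoly : ∀ {n} → Poly n → Poly n → Poly n
mulPoly p q = concatMap (λ t → map (λ s → (proj₁ t ℤ.* proj₁ s , zipWith _+_ (proj₂ t) (proj₂ s))) q) p

coeff : ∀ {n} → Poly n → Vec ℕ n → ℤ
coeff [] e = 0ℤ
coeff ((c , e') ∷ p) e with ≡-dec ℕ._≟_ e' e
... | yes _ = c ℤ.+ coeff p e
... | no  _ = coeff p e

-- A graph given by its list of edges; an orientation σ chooses, for the
-- i-th edge {a,b} of the list, whether it contributes (x_a - x_b) (σ i = false)
-- or (x_b - x_a) (σ i = true).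
orientedFactors : ∀ {n} → List (Fin n × Fin n) → (ℕ → Bool) → List (Poly n)
orientedFactors es σ =
  map (λ ie → let i = proj₁ ie ; a = proj₁ (proj₂ ie) ; b = proj₂ (proj₂ ie) in
              if σ i then diffPoly b a else diffPoly a b)
      (zip (upTo (Data.List.length es)) es)

graphPoly : ∀ {n} → List (Fin n × Fin n) → (ℕ → Bool) → Poly n
graphPoly es σ = foldr mulPoly onePoly (orientedFactors es σ)

pathEdges : (k : ℕ) → List (Fin k × Fin k)
pathEdges zero = []
pathEdges (suc zero) = []
pathEdges (suc (suc m)) = (zero , suc zero) ∷ map (λ e → (suc (proj₁ e) , suc (proj₂ e))) (pathEdges (suc m))

-- The graph G of the lemma, on vertex set Fin (suc k):
-- vertex 0 is u, vertex suc i is v_{i+1}.  Edges: u v_i (all i) and v_i v_{i+1}.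
fanEdges : (k : ℕ) → List (Fin (suc k) × Fin (suc k))
fanEdges k = map (λ i → (zero , suc i)) (allFin k)
      Data.List.++ map (λ e → (suc (proj₁ e) , suc (proj₂ e))) (pathEdges k)

mono₁ : (k : ℕ) → Vec ℕ (suc k)
mono₁ k = 1 ∷ tabulate (λ i → if toℕ i ℕ.≡ᵇ 0 then 0 else 2)

mono₂ : (k : ℕ) → Vec ℕ (suc k)
mono₂ k = 1 ∷ tabulate (λ i → if toℕ i ℕ.≡ᵇ pred k then 0 else 2)

{-# OPTIONS --safe #-}
-- Expanding P(G) = ∏ (x_a − x_b) amounts to choosing one endpoint of every edge, and the
-- coefficient of x^e is a signed count of the choices whose product is x^e.  Taking the edges
-- in the order u v_1, …, u v_k, v_1 v_2, …, v_{k-1} v_k, each monomial admits exactly one such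
-- choice: at every edge either one endpoint is already exhausted, or choosing it leads to a dead
-- end.  For the second monomial, u v_i (i < k) cannot take u since u v_k would then join two
-- exhausted vertices, and v_i v_{i+1} cannot take v_{i+1} since the rest of the path would have
-- more edges than exponent.  Hence the coefficient is ±1 whatever the orientation.
module Submission where

open import Defs
open import Data.Nat using (ℕ; _<_)
open import Data.Integer using (0ℤ)
open import Data.Bool using (Bool)
open import Data.Product using (_×_)
open import Relation.Binary.PropositionalEquality using (_≢_)

open import Data.Nat using (zero; suc; _+_)
import Data.Nat.Properties as ℕ
open import Data.Integer using (ℤ; 1ℤ; -1ℤ; -_; ∣_∣)
  renaming (_+_ to _+ℤ_; _*_ to _*ℤ_)
import Data.Integer.Properties as ℤ
open import Data.Fin using (Fin; zero; suc; punchIn)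
open import Data.Vec as Vec using (Vec; []; _∷_; _∷ʳ_; lookup; insertAt; replicate; zipWith)
open import Data.Vec.Properties
  using (≡-dec; ∷-injectiveˡ; ∷-injectiveʳ; insertAt-punchIn; zipWith-identityˡ; tabulate-∘; map-const; map-replicate)
open import Data.List as List using (List; []; _∷_; _++_; length; upTo; zip)
import Data.List.Properties as List
open import Data.List.Relation.Binary.Pointwise using (Pointwise; []; _∷_)
open import Data.Product using (_,_; proj₁; proj₂)
import Data.Product as Product
open import Data.Sum using (_⊎_; inj₁; inj₂; swap)
open import Data.Bool using (true; false; if_then_else_)
open import Data.Empty using (⊥-elim)
open import Relation.Nullary using (yes; no)
open import Function using (_∘_)
open import Relation.Binary.PropositionalEquality
  using (_≡_; refl; sym; trans; cong; cong₂; subst₂; module ≡-Reasoning)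

infixl 6 _⊕_
_⊕_ : ∀ {n} → Vec ℕ n → Vec ℕ n → Vec ℕ n
_⊕_ = zipWith _+_

⊕-cancelˡ : ∀ {n} (v s t : Vec ℕ n) → v ⊕ s ≡ v ⊕ t → s ≡ t
⊕-cancelˡ []       []       []       _  = refl
⊕-cancelˡ (x ∷ v) (y ∷ s) (z ∷ t) eq =
  cong₂ _∷_ (ℕ.+-cancelˡ-≡ x y z (∷-injectiveˡ eq)) (⊕-cancelˡ v s t (∷-injectiveʳ eq))

lookup-unitExp-⊕ : ∀ {n} (a : Fin n) (s : Vec ℕ n) → lookup (unitExp a ⊕ s) a ≡ suc (lookup s a)
lookup-unitExp-⊕ zero    (x ∷ s) = refl
lookup-unitExp-⊕ (suc a) (x ∷ s) = lookup-unitExp-⊕ a s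

data Lower : ∀ {n} → Fin n → Vec ℕ n → Vec ℕ n → Set where
  here  : ∀ {n x} {e : Vec ℕ n} → Lower zero (suc x ∷ e) (x ∷ e)
  there : ∀ {n x a} {e e' : Vec ℕ n} → Lower a e e' → Lower (suc a) (x ∷ e) (x ∷ e')

lower⇒≡ : ∀ {n a} {e e' : Vec ℕ n} → Lower a e e' → e ≡ unitExp a ⊕ e'
lower⇒≡ here      = cong (_ ∷_) (sym (zipWith-identityˡ ℕ.+-identityˡ _))
lower⇒≡ (there l) = cong (_ ∷_) (lower⇒≡ l)

-- c · x_a · R, in the shape produced by mulPoly
shift : ∀ {n} → ℤ → Fin n → Poly n → Poly n
shift c a = List.map (λ s → (c *ℤ proj₁ s , unitExp a ⊕ proj₂ s))

coeff-++ : ∀ {n} (p q : Poly n) e → coeff (p ++ q) e ≡ coeff p e +ℤ coeff q e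
coeff-++ []             q e = sym (ℤ.+-identityˡ _)
coeff-++ ((c , s) ∷ p) q e with ≡-dec ℕ._≟_ s e
... | yes _ = trans (cong (c +ℤ_) (coeff-++ p q e)) (sym (ℤ.+-assoc c _ _))
... | no  _ = coeff-++ p q e

coeff-mulPoly-diffPoly : ∀ {n} (a b : Fin n) Q e →
  coeff (mulPoly (diffPoly a b) Q) e ≡ coeff (shift 1ℤ a Q) e +ℤ (coeff (shift -1ℤ b Q) e +ℤ 0ℤ)
coeff-mulPoly-diffPoly a b Q e = trans (coeff-++ (shift 1ℤ a Q) _ e)
  (cong (coeff (shift 1ℤ a Q) e +ℤ_) (coeff-++ (shift -1ℤ b Q) [] e))

coeff-shift-exhausted : ∀ {n} c (a : Fin n) R {e} → lookup e a ≡ 0 → coeff (shift c a R) e ≡ 0ℤ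
coeff-shift-exhausted c a []            ea≡0 = refl
coeff-shift-exhausted c a ((d , s) ∷ R) {e} ea≡0 with ≡-dec ℕ._≟_ (unitExp a ⊕ s) e
... | yes refl with () ← trans (sym (lookup-unitExp-⊕ a s)) ea≡0
... | no  _    = coeff-shift-exhausted c a R ea≡0

coeff-shift-unitExp : ∀ {n} c (a : Fin n) R e → coeff (shift c a R) (unitExp a ⊕ e) ≡ c *ℤ coeff R e
coeff-shift-unitExp c a []            e = sym (ℤ.*-zeroʳ c)
coeff-shift-unitExp c a ((d , s) ∷ R) e
  with ≡-dec ℕ._≟_ (unitExp a ⊕ s) (unitExp a ⊕ e) | ≡-dec ℕ._≟_ s e
... | yes _  | yes _   = trans (cong (c *ℤ d +ℤ_) (coeff-shift-unitExp c a R e)) (sym (ℤ.*-distribˡ-+ c d _))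
... | yes eq | no s≢e  = ⊥-elim (s≢e (⊕-cancelˡ _ _ _ eq))
... | no ne  | yes s≡e = ⊥-elim (ne (cong (unitExp a ⊕_) s≡e))
... | no  _  | no  _   = coeff-shift-unitExp c a R e

coeff-shift-lower : ∀ {n} c {a : Fin n} R {e e'} → Lower a e e' → coeff (shift c a R) e ≡ c *ℤ coeff R e'
coeff-shift-lower c {a} R {e' = e'} l rewrite lower⇒≡ l = coeff-shift-unitExp c a R e'

Edge : ℕ → Set
Edge n = Fin n × Fin n

Factor : ∀ {n} → Edge n → Poly n → Set
Factor (a , b) f = f ≡ diffPoly a b ⊎ f ≡ diffPoly b a

factor-blocked : ∀ {n} {a b : Fin n} {f} Q e → Factor (a , b) f →
  (∀ c → coeff (shift c a Q) e ≡ 0ℤ) → (∀ c → coeff (shift c b Q) e ≡ 0ℤ) →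
  coeff (mulPoly f Q) e ≡ 0ℤ
factor-blocked {a = a} {b} Q e (inj₁ refl) za zb =
  trans (coeff-mulPoly-diffPoly a b Q e) (cong₂ (λ x y → x +ℤ (y +ℤ 0ℤ)) (za 1ℤ) (zb -1ℤ))
factor-blocked Q e (inj₂ refl) za zb = factor-blocked Q e (inj₁ refl) zb za

factor-forced : ∀ {n} {a b : Fin n} {f} Q {e e'} → Factor (a , b) f →
  Lower a e e' → (∀ c → coeff (shift c b Q) e ≡ 0ℤ) →
  ∣ coeff (mulPoly f Q) e ∣ ≡ ∣ coeff Q e' ∣
factor-forced {a = a} {b} Q {e} {e'} (inj₁ refl) l zb = begin
  ∣ coeff (mulPoly (diffPoly a b) Q) e ∣                          ≡⟨ cong ∣_∣ (coeff-mulPoly-diffPoly a b Q e) ⟩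
  ∣ coeff (shift 1ℤ a Q) e +ℤ (coeff (shift -1ℤ b Q) e +ℤ 0ℤ) ∣  ≡⟨ cong₂ (λ x y → ∣ x +ℤ (y +ℤ 0ℤ) ∣) (coeff-shift-lower 1ℤ Q l) (zb -1ℤ) ⟩
  ∣ 1ℤ *ℤ coeff Q e' +ℤ 0ℤ ∣                                      ≡⟨ cong ∣_∣ (trans (ℤ.+-identityʳ (1ℤ *ℤ coeff Q e')) (ℤ.*-identityˡ (coeff Q e'))) ⟩
  ∣ coeff Q e' ∣                                                  ∎
  where open ≡-Reasoning
factor-forced {a = a} {b} Q {e} {e'} (inj₂ refl) l zb = begin
  ∣ coeff (mulPoly (diffPoly b a) Q) e ∣                          ≡⟨ cong ∣_∣ (coeff-mulPoly-diffPoly b a Q e) ⟩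
  ∣ coeff (shift 1ℤ b Q) e +ℤ (coeff (shift -1ℤ a Q) e +ℤ 0ℤ) ∣  ≡⟨ cong₂ (λ x y → ∣ x +ℤ (y +ℤ 0ℤ) ∣) (zb 1ℤ) (coeff-shift-lower -1ℤ Q l) ⟩
  ∣ 0ℤ +ℤ (-1ℤ *ℤ coeff Q e' +ℤ 0ℤ) ∣                             ≡⟨ cong ∣_∣ (trans (ℤ.+-identityˡ _) (trans (ℤ.+-identityʳ (-1ℤ *ℤ coeff Q e')) (ℤ.-1*i≡-i (coeff Q e')))) ⟩
  ∣ - coeff Q e' ∣                                                ≡⟨ ℤ.∣-i∣≡∣i∣ (coeff Q e') ⟩
  ∣ coeff Q e' ∣                                                  ∎
  where open ≡-Reasoning

-- Certificates about choosing one endpoint of each edge, read as a monomial (Lower a e e' : x^e = x_a · x^e').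
-- Blocked es e: no choice divides x^e.  BlockedAfter a es e: x_a times no choice divides x^e.
-- Forced es e t: exactly one choice divides x^e, and its cofactor is x^t.
mutual
  data Blocked {n} : List (Edge n) → Vec ℕ n → Set where
    both : ∀ {a b es e} → BlockedAfter a es e → BlockedAfter b es e → Blocked ((a , b) ∷ es) e

  data BlockedAfter {n} (a : Fin n) (es : List (Edge n)) (e : Vec ℕ n) : Set where
    exhausted : lookup e a ≡ 0 → BlockedAfter a es e
    lower     : ∀ {e'} → Lower a e e' → Blocked es e' → BlockedAfter a es e

data Forced {n} : List (Edge n) → Vec ℕ n → Vec ℕ n → Set where
  done  : ∀ {e} → Forced [] e e
  left  : ∀ {a b es e e' t} → Lower a e e' → BlockedAfter b es e → Forced es e' t → Forced ((a , b) ∷ es) e t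
  right : ∀ {a b es e e' t} → BlockedAfter a es e → Lower b e e' → Forced es e' t → Forced ((a , b) ∷ es) e t

mutual
  blocked-sound : ∀ {n} {es : List (Edge n)} {e fs} → Blocked es e → Pointwise Factor es fs →
    ∀ R → coeff (List.foldr mulPoly R fs) e ≡ 0ℤ
  blocked-sound {e = e} {_ ∷ fs} (both za zb) (φ ∷ φs) R =
    factor-blocked (List.foldr mulPoly R fs) e φ (blockedAfter-sound za φs R) (blockedAfter-sound zb φs R)

  blockedAfter-sound : ∀ {n} {a : Fin n} {es e fs} → BlockedAfter a es e → Pointwise Factor es fs →
    ∀ R c → coeff (shift c a (List.foldr mulPoly R fs)) e ≡ 0ℤ
  blockedAfter-sound {a = a} {fs = fs} (exhausted ea≡0) φs R c =
    coeff-shift-exhausted c a (List.foldr mulPoly R fs) ea≡0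
  blockedAfter-sound {fs = fs} (lower l B) φs R c = begin
    coeff (shift c _ (List.foldr mulPoly R fs)) _  ≡⟨ coeff-shift-lower c (List.foldr mulPoly R fs) l ⟩
    c *ℤ coeff (List.foldr mulPoly R fs) _         ≡⟨ cong (c *ℤ_) (blocked-sound B φs R) ⟩
    c *ℤ 0ℤ                                        ≡⟨ ℤ.*-zeroʳ c ⟩
    0ℤ                                             ∎
    where open ≡-Reasoning

forced-sound : ∀ {n} {es : List (Edge n)} {e t fs} → Forced es e t → Pointwise Factor es fs →
  ∀ R → ∣ coeff (List.foldr mulPoly R fs) e ∣ ≡ ∣ coeff R t ∣
forced-sound done           []       R = refl
forced-sound (left l zb F)  (φ ∷ φs) R =
  trans (factor-forced _ φ l (blockedAfter-sound zb φs R)) (forced-sound F φs R)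
forced-sound (right za l F) (φ ∷ φs) R =
  trans (factor-forced _ (swap φ) l (blockedAfter-sound za φs R)) (forced-sound F φs R)

punchInEdge : ∀ {n} → Fin (suc n) → Edge n → Edge (suc n)
punchInEdge i = Product.map (punchIn i) (punchIn i)

lower-insertAt : ∀ {n} (i : Fin (suc n)) y {a e e'} → Lower a e e' →
  Lower (punchIn i a) (insertAt e i y) (insertAt e' i y)
lower-insertAt zero    y l         = there l
lower-insertAt (suc i) y here      = here
lower-insertAt (suc i) y (there l) = there (lower-insertAt i y l)

mutual
  blocked-insertAt : ∀ {n} (i : Fin (suc n)) y {es e} → Blocked es e →
    Blocked (List.map (punchInEdge i) es) (insertAt e i y)
  blocked-insertAt i y (both za zb) = both (blockedAfter-insertAt i y za) (blockedAfter-insertAt i y zb)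

  blockedAfter-insertAt : ∀ {n} (i : Fin (suc n)) y {a es e} → BlockedAfter a es e →
    BlockedAfter (punchIn i a) (List.map (punchInEdge i) es) (insertAt e i y)
  blockedAfter-insertAt i y {a} {e = e} (exhausted ea≡0) = exhausted (trans (insertAt-punchIn e i y a) ea≡0)
  blockedAfter-insertAt i y (lower l B) = lower (lower-insertAt i y l) (blocked-insertAt i y B)

forced-insertAt : ∀ {n} (i : Fin (suc n)) y {es e t} → Forced es e t →
  Forced (List.map (punchInEdge i) es) (insertAt e i y) (insertAt t i y)
forced-insertAt i y done           = done
forced-insertAt i y (left l zb F)  = left (lower-insertAt i y l) (blockedAfter-insertAt i y zb) (forced-insertAt i y F)
forced-insertAt i y (right za l F) = right (blockedAfter-insertAt i y za) (lower-insertAt i y l) (forced-insertAt i y F)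

mutual
  blocked-++ : ∀ {n} {es : List (Edge n)} fs {e} → Blocked es e → Blocked (es ++ fs) e
  blocked-++ fs (both za zb) = both (blockedAfter-++ fs za) (blockedAfter-++ fs zb)

  blockedAfter-++ : ∀ {n} {a : Fin n} {es} fs {e} → BlockedAfter a es e → BlockedAfter a (es ++ fs) e
  blockedAfter-++ fs (exhausted ea≡0) = exhausted ea≡0
  blockedAfter-++ fs (lower l B)      = lower l (blocked-++ fs B)

forced-++ : ∀ {n} {es fs : List (Edge n)} {e t t'} → Forced es e t → Forced fs t t' → Forced (es ++ fs) e t'
forced-++ done           G = G
forced-++ (left l zb F)  G = left l (blockedAfter-++ _ zb) (forced-++ F G)
forced-++ (right za l F) G = right (blockedAfter-++ _ za) l (forced-++ F G)

starEdges : ∀ n → List (Edge (suc n))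
starEdges zero    = []
starEdges (suc n) = (zero , suc zero) ∷ List.map (punchInEdge (suc zero)) (starEdges n)

star-forced-leaves : ∀ n (w : Vec ℕ n) → Forced (starEdges n) (0 ∷ Vec.map suc w) (0 ∷ w)
star-forced-leaves zero    []      = done
star-forced-leaves (suc n) (x ∷ w) =
  right (exhausted refl) (there here) (forced-insertAt (suc zero) x (star-forced-leaves n w))

-- the last edge joins two exhausted vertices
star-blocked : ∀ n (w : Vec ℕ n) → Blocked (starEdges (suc n)) (0 ∷ (Vec.map suc w ∷ʳ 0))
star-blocked zero    []      = both (exhausted refl) (exhausted refl)
star-blocked (suc n) (x ∷ w) =
  both (exhausted refl) (lower (there here) (blocked-insertAt (suc zero) x (star-blocked n w)))

star-forced-last : ∀ n (w : Vec ℕ n) → Forced (starEdges (suc n)) (1 ∷ (Vec.map suc w ∷ʳ 0)) (0 ∷ (w ∷ʳ 0))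
star-forced-last zero    []      = left here (exhausted refl) done
star-forced-last (suc n) (x ∷ w) =
  right (lower here (blocked-insertAt (suc zero) (suc x) (star-blocked n w)))
        (there here)
        (forced-insertAt (suc zero) x (star-forced-last n w))

path-forced-right : ∀ m → Forced (pathEdges (suc m)) (0 ∷ replicate m 1) (replicate (suc m) 0)
path-forced-right zero    = done
path-forced-right (suc m) = right (exhausted refl) (there here) (forced-insertAt zero 0 (path-forced-right m))

-- n + 1 edges against total exponent n
path-blocked : ∀ n → Blocked (pathEdges (suc (suc n))) (0 ∷ (replicate n 1 ∷ʳ 0))
path-blocked zero    = both (exhausted refl) (exhausted refl)
path-blocked (suc n) = both (exhausted refl) (lower (there here) (blocked-insertAt zero 0 (path-blocked n)))

path-forced-left : ∀ m → Forced (pathEdges (suc m)) (replicate m 1 ∷ʳ 0) (replicate (suc m) 0)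
path-forced-left zero          = done
path-forced-left (suc zero)    = left here (exhausted refl) (forced-insertAt zero 0 done)
path-forced-left (suc (suc m)) =
  left here (lower (there here) (blocked-insertAt zero 1 (path-blocked m)))
       (forced-insertAt zero 0 (path-forced-left (suc m)))

starEdges-allFin : ∀ n → List.map (λ i → (zero , suc i)) (List.allFin n) ≡ starEdges n
starEdges-allFin zero    = refl
starEdges-allFin (suc n) = cong ((zero , suc zero) ∷_) (begin
  List.map (λ i → (zero , suc i)) (List.tabulate suc)            ≡⟨ List.map-tabulate suc _ ⟩
  List.tabulate (λ i → (zero , suc (suc i)))                    ≡⟨ List.map-tabulate (λ i → i) _ ⟨
  List.map (punchInEdge (suc zero) ∘ leaf) (List.allFin n)       ≡⟨ List.map-∘ (List.allFin n) ⟩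
  List.map (punchInEdge (suc zero)) (List.map leaf (List.allFin n)) ≡⟨ cong (List.map (punchInEdge (suc zero))) (starEdges-allFin n) ⟩
  List.map (punchInEdge (suc zero)) (starEdges n)                ∎)
  where
  open ≡-Reasoning
  leaf : Fin n → Edge (suc n)
  leaf i = (zero , suc i)

fanEdges-++ : ∀ k → fanEdges k ≡ starEdges k ++ List.map (punchInEdge zero) (pathEdges k)
fanEdges-++ k = cong (_++ List.map (punchInEdge zero) (pathEdges k)) (starEdges-allFin k)

mono₁-suc : ∀ m → mono₁ (suc m) ≡ 1 ∷ 0 ∷ Vec.map suc (replicate m 1)
mono₁-suc m = cong (λ v → 1 ∷ 0 ∷ v) (begin
  Vec.tabulate (λ _ → 2)                  ≡⟨ tabulate-∘ (λ _ → 2) (λ i → i) ⟩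
  Vec.map (λ _ → 2) (Vec.allFin m)        ≡⟨ map-const (Vec.allFin m) 2 ⟩
  replicate m 2                           ≡⟨ map-replicate suc 1 m ⟨
  Vec.map suc (replicate m 1)             ∎)
  where open ≡-Reasoning

mono₂-suc : ∀ m → mono₂ (suc m) ≡ 1 ∷ (Vec.map suc (replicate m 1) ∷ʳ 0)
mono₂-suc zero    = refl
mono₂-suc (suc m) = cong (λ v → 1 ∷ 2 ∷ Vec.tail v) (mono₂-suc m)

fan-forced₁ : ∀ m → Forced (fanEdges (suc m)) (mono₁ (suc m)) (replicate (suc (suc m)) 0)
fan-forced₁ m = subst₂ (λ es e → Forced es e (replicate (suc (suc m)) 0)) (sym (fanEdges-++ (suc m))) (sym (mono₁-suc m))
  (forced-++ (left here (exhausted refl) (forced-insertAt (suc zero) 0 (star-forced-leaves m (replicate m 1))))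
             (forced-insertAt zero 0 (path-forced-right m)))

fan-forced₂ : ∀ m → Forced (fanEdges (suc m)) (mono₂ (suc m)) (replicate (suc (suc m)) 0)
fan-forced₂ m = subst₂ (λ es e → Forced es e (replicate (suc (suc m)) 0)) (sym (fanEdges-++ (suc m))) (sym (mono₂-suc m))
  (forced-++ (star-forced-last m (replicate m 1)) (forced-insertAt zero 0 (path-forced-left m)))

factor-if : ∀ {n} x (a b : Fin n) → Factor (a , b) (if x then diffPoly b a else diffPoly a b)
factor-if true  a b = inj₂ refl
factor-if false a b = inj₁ refl

orient : ∀ {n} → (ℕ → Bool) → ℕ × Edge n → Poly n
orient σ (i , (a , b)) = if σ i then diffPoly b a else diffPoly a b

zip-factors : ∀ {n} σ (is : List ℕ) (es : List (Edge n)) → length is ≡ length es →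
  Pointwise Factor es (List.map (orient σ) (zip is es))
zip-factors σ []       []             _  = []
zip-factors σ (i ∷ is) ((a , b) ∷ es) eq = factor-if (σ i) a b ∷ zip-factors σ is es (ℕ.suc-injective eq)

orientedFactors-factors : ∀ {n} (es : List (Edge n)) σ → Pointwise Factor es (orientedFactors es σ)
orientedFactors-factors es σ = zip-factors σ (upTo (length es)) es (List.length-upTo (length es))

coeff-onePoly : ∀ {n} → coeff (onePoly {n}) (replicate n 0) ≡ 1ℤ
coeff-onePoly {n} with ≡-dec ℕ._≟_ (replicate n 0) (replicate n 0)
... | yes _  = refl
... | no  ≢0 = ⊥-elim (≢0 refl)

forced-graphPoly : ∀ {n} {es : List (Edge n)} {e} → Forced es e (replicate n 0) →
  ∀ σ → coeff (graphPoly es σ) e ≢ 0ℤ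
forced-graphPoly {n} {es} F σ coeff≡0 = ℕ.0≢1+n (begin
  0                                   ≡⟨ cong ∣_∣ coeff≡0 ⟨
  ∣ coeff (graphPoly es σ) _ ∣        ≡⟨ forced-sound F (orientedFactors-factors es σ) onePoly ⟩
  ∣ coeff onePoly (replicate n 0) ∣   ≡⟨ cong ∣_∣ (coeff-onePoly {n}) ⟩
  1                                   ∎)
  where open ≡-Reasoning

lemma4p3 : (k : ℕ) → 1 < k → (σ : ℕ → Bool) →
    (coeff (graphPoly (fanEdges k) σ) (mono₁ k) ≢ 0ℤ)
    × (coeff (graphPoly (fanEdges k) σ) (mono₂ k) ≢ 0ℤ)
lemma4p3 zero    ()  σ
lemma4p3 (suc m) _  σ = forced-graphPoly (fan-forced₁ m) σ , forced-graphPoly (fan-forced₂ m) σ
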